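{- Let $A$ be a finite set of propositional atoms and let $P$ and $R$ be propositional Horn logic programs over $A$. Define the program \[ Q:=\left\{\, h(r)\leftarrow h(S) \;\middle|\; r\in P,\ S\subseteq R \text{ such that the rules of } S \text{ have pairwise distinct heads},\ b(S)=b(r),\ \{h(r)\leftarrow h(S)\}\circ R\subseteq P \,\right\}. \] Then $P\leq_{\mathcal L} R$ (that is, $P=Q'\circ R$ for some program $Q'$ over $A$) if and only if $P=Q\circ R$.
   Context: A propositional Horn logic program over a finite alphabet $A$ is a finite set of rules of the form $a_0\leftarrow a_1,\ldots,a_k$ with $k\ge 0$ and $a_0,\ldots,a_k\in A$. For such a rule $r$, its head is $h(r):=\{a_0\}$, its body is the set $b(r):=\{a_1,\ldots,a_k\}$, and its size $sz(r)$ is the number of body atoms $|b(r)|$. For a program $S$, $h(S):=\bigcup_{r\in S}h(r)$ and $b(S):=\bigcup_{r\in S}b(r)$; a rule $h(r)\leftarrow B$ with $B$ a finite set of atoms denotes the rule with head atom that of $r$ and body $B$ (if $h(r)=\{a_0\}$ we write $h(r)\leftarrow B$ for $a_0\leftarrow B$). The (sequential) composition of programs $P$ and $R$ is \[ P\circ R:=\{\, h(r)\leftarrow b(S) \mid r\in P,\ S\subseteq R,\ |S|=sz(r),\ h(S)=b(r)\,\}. \] Green's $\mathcal L$-relation: $P\leq_{\mathcal L} R$ iff $P=Q'\circ R$ for some program $Q'$ over $A$. -}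

module Defs where

open import Data.Nat using (ℕ)
open import Data.Fin using (Fin)
open import Data.Fin.Subset using (Subset; ⋃; ⁅_⁆; ∣_∣)
open import Data.Bool using (Bool; true)
open import Data.Product using (_×_; _,_; proj₁; proj₂; Σ; ∃; ∃-syntax)
open import Data.List using (List; map; length)
open import Data.List.Relation.Unary.All using (All)
open import Data.List.Relation.Unary.AllPairs using (AllPairs)
open import Data.List.Relation.Unary.Unique.Propositional using (Unique)
open import Relation.Binary.PropositionalEquality using (_≡_; _≢_)
open import Function.Bundles using (_⇔_)

-- Alphabet A = Fin n.  A rule  a₀ ← a₁,…,a_k  is a pair (head atom, body set).
Rule : ℕ → Set
Rule n = Fin n × Subset n

head : ∀ {n} → Rule n → Fin n
head = proj₁

body : ∀ {n} → Rule n → Subset n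
body = proj₂

sz : ∀ {n} → Rule n → ℕ
sz r = ∣ body r ∣

-- A program is a finite set of rules; since Rule n is a finite type,
-- a program is a (decidable) subset of it.
Program : ℕ → Set
Program n = Rule n → Bool

_∈P_ : ∀ {n} → Rule n → Program n → Set
ρ ∈P P = P ρ ≡ true

heads : ∀ {n} → List (Rule n) → Subset n
heads S = ⋃ (map (λ s → ⁅ head s ⁆) S)

bodies : ∀ {n} → List (Rule n) → Subset n
bodies S = ⋃ (map body S)

-- Membership in the composition  P ∘ R, where the left program is given
-- by an arbitrary predicate on rules (used for programs defined by comprehension).
-- S ⊆ R is a finite set of rules: a duplicate-free list of members of R.
InComp : ∀ {n} → (Rule n → Set) → Program n → Rule n → Set
InComp {n} p R ρ =
  ∃[ r ] (p r × ∃[ S ] (Unique S × All (λ s → s ∈P R) S ×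
                        length S ≡ sz r × heads S ≡ body r ×
                        ρ ≡ (head r , bodies S)))

EqComp : ∀ {n} → Program n → (Rule n → Set) → Program n → Set
EqComp {n} P p R = (ρ : Rule n) → (ρ ∈P P) ⇔ InComp p R ρ

_≤L_ : ∀ {n} → Program n → Program n → Set
_≤L_ {n} P R = ∃[ Q' ] EqComp P (λ r → r ∈P Q') R

InQ : ∀ {n} → Program n → Program n → Rule n → Set
InQ {n} P R ρ =
  ∃[ r ] (r ∈P P × ∃[ S ] (AllPairs (λ s t → head s ≢ head t) S ×
                           All (λ s → s ∈P R) S ×
                           bodies S ≡ body r ×
                           ((ρ' : Rule n) → InComp (λ q → q ≡ (head r , heads S)) R ρ' → ρ' ∈P P) ×
                           ρ ≡ (head r , heads S)))

-- If P = Q′ ∘ R, each q ∈ Q′ satisfies {q} ∘ R ⊆ P, and each ρ ∈ P arises from some q ∈ Q′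
-- and S ⊆ R with |S| = sz(q) = |h(S)|; so the heads in S are distinct and q = h(ρ) ← h(S) is a
-- rule of Q, whence P ⊆ Q ∘ R. The inclusion Q ∘ R ⊆ P holds for all P and R by the last
-- condition defining Q. Conversely, if P = Q ∘ R, take for Q′ the largest program with
-- Q′ ∘ R ⊆ P, i.e. the rules q with {q} ∘ R ⊆ P: it contains Q, so P = Q′ ∘ R. Over a finite
-- alphabet {q} ∘ R ⊆ P is decidable, which is what makes this Q′ a program.
module Submission where

open import Defs
open import Data.Bool using (true)
import Data.Bool as Bool
open import Data.Fin using (Fin)
import Data.Fin.Properties as Fin
open import Data.Fin.Subset using (Subset; ⋃; ⁅_⁆; ∣_∣; _∪_; _∈_; _⊆_; inside; outside)
open import Data.Fin.Subset.Properties
  using (∣⊥∣≡0; ∣⁅x⁆∣≡1; p⊆q⇒∣p∣≤∣q∣; x∈p∪q⁻; x∈p∪q⁺; x∈⁅x⁆; x∈⁅y⁆⇒x≡y; anySubset?)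
open import Data.List using (List; []; _∷_; map; length)
open import Data.List.Membership.Propositional using () renaming (_∈_ to _∈ₗ_)
open import Data.List.Properties using (length-map; map-∘)
open import Data.List.Relation.Unary.All as All using (All; all?)
open import Data.List.Relation.Unary.Any using (here; there)
open import Data.List.Relation.Unary.AllPairs using (AllPairs; []; _∷_)
import Data.List.Relation.Unary.AllPairs.Properties as AllPairs
open import Data.List.Relation.Unary.Unique.Propositional using (Unique)
open import Data.Nat using (ℕ; zero; suc; _+_; _≤_; z≤n; s≤s; s≤s⁻¹)
open import Data.Nat.Properties using (≤-refl; ≤-trans; ≤-antisym; ≤-reflexive; +-suc; m≤n⇒m≤1+n; n≮n; module ≤-Reasoning)
open import Data.Product using (_×_; _,_)
import Data.Product.Properties as Product
open import Data.Sum using (inj₁; inj₂)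
open import Data.Vec using ([]; _∷_)
import Data.Vec.Properties as Vec
open import Function using (_∘_)
open import Function.Bundles using (_⇔_; mk⇔; Equivalence)
open import Relation.Binary.Definitions using (DecidableEquality)
open import Relation.Binary.PropositionalEquality using (_≡_; _≢_; refl; sym; cong; subst; module ≡-Reasoning)
open import Relation.Nullary using (Dec; yes; no; ¬?; does; _→-dec_)
import Relation.Nullary.Decidable as Dec
open import Relation.Unary using (Decidable)

private
  variable
    n : ℕ

∣p∪q∣≤∣p∣+∣q∣ : (p q : Subset n) → ∣ p ∪ q ∣ ≤ ∣ p ∣ + ∣ q ∣
∣p∪q∣≤∣p∣+∣q∣ []            []            = z≤n
∣p∪q∣≤∣p∣+∣q∣ (outside ∷ p) (outside ∷ q) = ∣p∪q∣≤∣p∣+∣q∣ p q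
∣p∪q∣≤∣p∣+∣q∣ (outside ∷ p) (inside ∷ q)  = ≤-trans (s≤s (∣p∪q∣≤∣p∣+∣q∣ p q)) (≤-reflexive (sym (+-suc ∣ p ∣ ∣ q ∣)))
∣p∪q∣≤∣p∣+∣q∣ (inside ∷ p)  (outside ∷ q) = s≤s (∣p∪q∣≤∣p∣+∣q∣ p q)
∣p∪q∣≤∣p∣+∣q∣ (inside ∷ p)  (inside ∷ q)  =
  s≤s (≤-trans (m≤n⇒m≤1+n (∣p∪q∣≤∣p∣+∣q∣ p q)) (≤-reflexive (sym (+-suc ∣ p ∣ ∣ q ∣))))

x∈p⇒⁅x⁆∪p⊆p : {x : Fin n} {p : Subset n} → x ∈ p → ⁅ x ⁆ ∪ p ⊆ p
x∈p⇒⁅x⁆∪p⊆p {x = x} {p} x∈p y∈ with x∈p∪q⁻ ⁅ x ⁆ p y∈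
... | inj₁ y∈⁅x⁆ = subst (_∈ p) (sym (x∈⁅y⁆⇒x≡y x y∈⁅x⁆)) x∈p
... | inj₂ y∈p   = y∈p

atoms : List (Fin n) → Subset n
atoms xs = ⋃ (map ⁅_⁆ xs)

∣atoms∣≤length : (xs : List (Fin n)) → ∣ atoms xs ∣ ≤ length xs
∣atoms∣≤length {n} []       = ≤-reflexive (∣⊥∣≡0 n)
∣atoms∣≤length     (x ∷ xs) = begin
  ∣ ⁅ x ⁆ ∪ atoms xs ∣        ≤⟨ ∣p∪q∣≤∣p∣+∣q∣ ⁅ x ⁆ (atoms xs) ⟩
  ∣ ⁅ x ⁆ ∣ + ∣ atoms xs ∣    ≡⟨ cong (_+ ∣ atoms xs ∣) (∣⁅x⁆∣≡1 x) ⟩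
  suc ∣ atoms xs ∣            ≤⟨ s≤s (∣atoms∣≤length xs) ⟩
  suc (length xs)             ∎
  where open ≤-Reasoning

∈ₗ⇒∈atoms : {x : Fin n} {xs : List (Fin n)} → x ∈ₗ xs → x ∈ atoms xs
∈ₗ⇒∈atoms {x = x} (here refl) = x∈p∪q⁺ (inj₁ (x∈⁅x⁆ x))
∈ₗ⇒∈atoms         (there x∈)  = x∈p∪q⁺ (inj₂ (∈ₗ⇒∈atoms x∈))

length≡∣atoms∣⇒Unique : (xs : List (Fin n)) → length xs ≡ ∣ atoms xs ∣ → Unique xs
length≡∣atoms∣⇒Unique []       _   = []
length≡∣atoms∣⇒Unique (x ∷ xs) eq =
  All.tabulate x∉xs ∷ length≡∣atoms∣⇒Unique xs (≤-antisym length≤∣atoms∣ (∣atoms∣≤length xs))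
  where
  open ≤-Reasoning
  length≤∣atoms∣ : length xs ≤ ∣ atoms xs ∣
  length≤∣atoms∣ = s≤s⁻¹ (begin
    suc (length xs)              ≡⟨ eq ⟩
    ∣ ⁅ x ⁆ ∪ atoms xs ∣         ≤⟨ ∣p∪q∣≤∣p∣+∣q∣ ⁅ x ⁆ (atoms xs) ⟩
    ∣ ⁅ x ⁆ ∣ + ∣ atoms xs ∣     ≡⟨ cong (_+ ∣ atoms xs ∣) (∣⁅x⁆∣≡1 x) ⟩
    suc ∣ atoms xs ∣             ∎)
  x∉xs : {y : Fin _} → y ∈ₗ xs → x ≢ y
  x∉xs y∈xs refl = n≮n (length xs) (begin-strict
    length xs                    <⟨ ≤-refl ⟩
    suc (length xs)              ≡⟨ eq ⟩
    ∣ ⁅ x ⁆ ∪ atoms xs ∣         ≤⟨ p⊆q⇒∣p∣≤∣q∣ (x∈p⇒⁅x⁆∪p⊆p (∈ₗ⇒∈atoms y∈xs)) ⟩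
    ∣ atoms xs ∣                 ≤⟨ ∣atoms∣≤length xs ⟩
    length xs                    ∎)

length≡∣heads∣⇒distinctHeads : (S : List (Rule n)) → length S ≡ ∣ heads S ∣ →
                                AllPairs (λ s t → head s ≢ head t) S
length≡∣heads∣⇒distinctHeads S eq = AllPairs.map⁻ (length≡∣atoms∣⇒Unique (map head S) (begin
  length (map head S)          ≡⟨ length-map head S ⟩
  length S                     ≡⟨ eq ⟩
  ∣ heads S ∣                  ≡⟨ cong (∣_∣ ∘ ⋃) (map-∘ S) ⟩
  ∣ atoms (map head S) ∣       ∎))
  where open ≡-Reasoning

Exhaustible : Set → Set₁
Exhaustible A = {P : A → Set} → Decidable P → Dec (∀ x → P x)

exhaustible-Subset : Exhaustible (Subset n)
exhaustible-Subset P? with anySubset? (¬? ∘ P?)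
... | yes (p , ¬Pp) = no (λ ∀P → ¬Pp (∀P p))
... | no ¬∃¬P       = yes (λ p → Dec.decidable-stable (P? p) (λ ¬Pp → ¬∃¬P (p , ¬Pp)))

exhaustible-× : {A B : Set} → Exhaustible A → Exhaustible B → Exhaustible (A × B)
exhaustible-× ∀A? ∀B? P? =
  Dec.map′ (λ ∀P (a , b) → ∀P a b) (λ ∀P a b → ∀P (a , b)) (∀A? (λ a → ∀B? (λ b → P? (a , b))))

exhaustible-Rule : Exhaustible (Rule n)
exhaustible-Rule = exhaustible-× Fin.all? exhaustible-Subset

∀-ofLength? : {A : Set} → Exhaustible A → {P : List A → Set} → Decidable P →
              ∀ k → Dec (∀ xs → length xs ≡ k → P xs)
∀-ofLength? ∀A? P? zero    = Dec.map′ (λ { P[] [] refl → P[] }) (λ ∀P → ∀P [] refl) (P? [])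
∀-ofLength? ∀A? P? (suc k) =
  Dec.map′ (λ { ∀P (x ∷ xs) refl → ∀P x xs refl }) (λ ∀P x xs eq → ∀P (x ∷ xs) (cong suc eq))
           (∀A? (λ x → ∀-ofLength? ∀A? (P? ∘ (x ∷_)) k))

rule≟ : DecidableEquality (Rule n)
rule≟ = Product.≡-dec Fin._≟_ (Vec.≡-dec Bool._≟_)

does≡true⇒ : {A : Set} (a? : Dec A) → does a? ≡ true → A
does≡true⇒ (yes a) _  = a
does≡true⇒ (no _)  ()

InComp-mono : {p p′ : Rule n → Set} (R : Program n) → (∀ {r} → p r → p′ r) →
              ∀ {ρ} → InComp p R ρ → InComp p′ R ρ
InComp-mono R p⊆p′ (r , pr , rest) = r , p⊆p′ pr , rest

module _ (P R : Program n) where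

  open import Data.List.Relation.Unary.Unique.DecPropositional (rule≟ {n}) using (unique?)

  Admissible : Rule n → Set
  Admissible q = ∀ ρ → InComp (_≡ q) R ρ → ρ ∈P P

  comp⊆⇒admissible : {p : Rule n → Set} → (∀ ρ → InComp p R ρ → ρ ∈P P) → ∀ {r} → p r → Admissible r
  comp⊆⇒admissible p∘R⊆P pr ρ ρ∈r∘R = p∘R⊆P ρ (InComp-mono R (λ { refl → pr }) ρ∈r∘R)

  admissible⇒comp⊆ : {p : Rule n → Set} → (∀ {r} → p r → Admissible r) → ∀ ρ → InComp p R ρ → ρ ∈P P
  admissible⇒comp⊆ adm ρ (r , pr , rest) = adm pr ρ (r , refl , rest)

  InQ⇒admissible : ∀ {q} → InQ P R q → Admissible q
  InQ⇒admissible (_ , _ , _ , _ , _ , _ , adm , refl) = adm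

  InComp⇒InComp-InQ : {p : Rule n → Set} → (∀ {r} → p r → Admissible r) →
                      ∀ {ρ} → ρ ∈P P → InComp p R ρ → InComp (InQ P R) R ρ
  InComp⇒InComp-InQ adm {ρ} ρ∈P ((a , _) , pr , S , u , S⊆R , len , refl , refl) =
    (a , heads S) , (ρ , ρ∈P , S , length≡∣heads∣⇒distinctHeads S len , S⊆R , refl , adm pr , refl) ,
    S , u , S⊆R , len , refl , refl

  admissible? : Decidable Admissible
  admissible? q = Dec.map (mk⇔ fold unfold) (∀-ofLength? exhaustible-Rule (λ S →
      unique? S →-dec all? (λ s → R s Bool.≟ true) S →-dec
      Vec.≡-dec Bool._≟_ (heads S) (body q) →-dec P (head q , bodies S) Bool.≟ true) (sz q))
    where
    Unfolded : Set
    Unfolded = ∀ S → length S ≡ sz q → Unique S → All (_∈P R) S → heads S ≡ body q → (head q , bodies S) ∈P P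
    fold : Unfolded → Admissible q
    fold h _ (_ , refl , S , u , S⊆R , len , hds , refl) = h S len u S⊆R hds
    unfold : Admissible q → Unfolded
    unfold adm S len u S⊆R hds = adm _ (q , refl , S , u , S⊆R , len , hds , refl)

  residual : Program n
  residual q = does (admissible? q)

  ∈residual⇒admissible : ∀ {q} → q ∈P residual → Admissible q
  ∈residual⇒admissible {q} = does≡true⇒ (admissible? q)

  admissible⇒∈residual : ∀ {q} → Admissible q → q ∈P residual
  admissible⇒∈residual {q} = Dec.dec-true (admissible? q)

mainTheorem1 : {n : ℕ} (P R : Program n) → (P ≤L R) ⇔ EqComp P (InQ P R) R
mainTheorem1 P R = mk⇔ P≤LR⇒P≡Q∘R P≡Q∘R⇒P≤LR
  where
  P≤LR⇒P≡Q∘R : P ≤L R → EqComp P (InQ P R) R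
  P≤LR⇒P≡Q∘R (Q′ , P≡Q′∘R) ρ = mk⇔
    (λ ρ∈P → InComp⇒InComp-InQ P R Q′-admissible ρ∈P (Equivalence.to (P≡Q′∘R ρ) ρ∈P))
    (admissible⇒comp⊆ P R (InQ⇒admissible P R) ρ)
    where
    Q′-admissible : ∀ {r} → r ∈P Q′ → Admissible P R r
    Q′-admissible = comp⊆⇒admissible P R (λ ρ′ → Equivalence.from (P≡Q′∘R ρ′))

  P≡Q∘R⇒P≤LR : EqComp P (InQ P R) R → P ≤L R
  P≡Q∘R⇒P≤LR P≡Q∘R = residual P R , λ ρ → mk⇔
    (λ ρ∈P → InComp-mono R (admissible⇒∈residual P R ∘ InQ⇒admissible P R) (Equivalence.to (P≡Q∘R ρ) ρ∈P))
    (admissible⇒comp⊆ P R (∈residual⇒admissible P R) ρ)
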